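{- Let a model of linear dependent type theory support $\Sigma$-types. Then for every object $C \in \mathcal{L}_{\Gamma.\Sigma_AB}$, every object $\Xi\in\mathcal{L}_{\Gamma.A.B}$, every morphism $c : \Xi \to pair_{A,B}^*C$ in $\mathcal{L}_{\Gamma.A.B}$ and every section $s : \Gamma \to \Gamma.\Sigma_AB$, there exists a morphism $\hat c_s : s^*(pr_1,pr_2)^*\Xi \to s^*C$ in $\mathcal{L}_\Gamma$ such that, for all sections $a : \Gamma \to \Gamma.A$ and $b : \Gamma.A \to \Gamma.A.B$, writing $(a,b) = pair\circ b\circ a$, we have $\hat c_{(a,b)} = a^*b^*c : a^*b^*\Xi \to a^*b^*C$.
   Context: A model of linear dependent type theory consists of a category $\mathcal{C}$ with terminal object, a full split comprehension category $\pi:\mathcal{T}\to\mathcal{C}^{\to}$ (so $p = \mathrm{cod}\circ\pi : \mathcal{T}\to\mathcal{C}$ is a split fibration; for $A$ in the fiber $\mathcal{T}_\Gamma$ we write $\pi(A) = \pi_A : \Gamma.A\to\Gamma$), and a split symmetric monoidal fibration $q:\mathcal{L}\to\mathcal{C}$ (a split fibration whose fibers $\mathcal{L}_\Gamma$ are symmetric monoidal with strict monoidal reindexing functors). For $f:\Delta\to\Gamma$ in $\mathcal{C}$, $f^*$ denotes the (split, so strictly functorial) reindexing functor on $\mathcal{T}$ or $\mathcal{L}$; for composable $f,g$ we write $f^*g^* = (g\circ f)^*$. A section of $\pi_X:\Gamma.X\to\Gamma$ is a morphism $s$ with $\pi_X\circ s=\mathrm{id}$. The model supports $\Sigma$-types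 if: (1) for every $A\in\mathcal{T}_\Gamma$, $\pi_A^*:\mathcal{T}_\Gamma\to\mathcal{T}_{\Gamma.A}$ has a left adjoint $\Sigma_A$; (2) for every pullback square with $\pi_E$, $\pi_{E'}$, $f:\Gamma\to\Delta$ and $q_{E,E'}:\Gamma.E\to\Delta.E'$, the canonical transformation $\Sigma_E q_{E,E'}^*\to f^*\Sigma_{E'}$ is a natural isomorphism; (3) for $B\in\mathcal{T}_{\Gamma.A}$ the induced map $pair_{A,B}:\Gamma.A.B\to\Gamma.\Sigma_AB$ is an isomorphism, whose inverse is denoted $(pr_1,pr_2)$. -}

module Defs where

open import Level using (Level; _⊔_) renaming (suc to lsuc)
open import Data.Product using (Σ; Σ-syntax; _×_; _,_)
open import Relation.Binary.PropositionalEquality using (_≡_; refl; sym; trans; cong; subst)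
open import Relation.Binary.HeterogeneousEquality using (_≅_)

record Category (o ℓ : Level) : Set (lsuc (o ⊔ ℓ)) where
  infixr 9 _∘_
  field
    Obj  : Set o
    Hom  : Obj → Obj → Set ℓ
    id   : ∀ {X} → Hom X X
    _∘_  : ∀ {X Y Z} → Hom Y Z → Hom X Y → Hom X Z
    identityˡ : ∀ {X Y} (f : Hom X Y) → id ∘ f ≡ f
    identityʳ : ∀ {X Y} (f : Hom X Y) → f ∘ id ≡ f
    assoc     : ∀ {W X Y Z} (h : Hom Y Z) (g : Hom X Y) (f : Hom W X) →
                (h ∘ g) ∘ f ≡ h ∘ (g ∘ f)

open Category public using (Obj; Hom)

private
  variable
    o ℓ o' ℓ' o'' ℓ'' : Level

record HomEq (C : Category o ℓ) {X Y X' Y' : Obj C}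
             (f : Hom C X Y) (g : Hom C X' Y') : Set (o ⊔ ℓ) where
  constructor homEq
  field
    src : X ≡ X'
    tgt : Y ≡ Y'
    het : f ≅ g

record Functor (C : Category o ℓ) (D : Category o' ℓ') : Set (o ⊔ ℓ ⊔ o' ⊔ ℓ') where
  field
    F₀   : Obj C → Obj D
    F₁   : ∀ {X Y} → Hom C X Y → Hom D (F₀ X) (F₀ Y)
    F-id : ∀ {X} → F₁ (Category.id C {X}) ≡ Category.id D
    F-∘  : ∀ {X Y Z} (g : Hom C Y Z) (f : Hom C X Y) →
           F₁ (Category._∘_ C g f) ≡ Category._∘_ D (F₁ g) (F₁ f)

open Functor public using (F₀; F₁)

IdF : (C : Category o ℓ) → Functor C C
IdF C = record
  { F₀ = λ X → X ; F₁ = λ f → f ; F-id = refl ; F-∘ = λ g f → refl }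

_∘F_ : {C : Category o ℓ} {D : Category o' ℓ'} {E : Category o'' ℓ''} →
       Functor D E → Functor C D → Functor C E
_∘F_ {C = C} {D} {E} G F = record
  { F₀ = λ X → F₀ G (F₀ F X)
  ; F₁ = λ f → F₁ G (F₁ F f)
  ; F-id = trans (cong (F₁ G) (Functor.F-id F)) (Functor.F-id G)
  ; F-∘ = λ g f → trans (cong (F₁ G) (Functor.F-∘ F g f))
                        (Functor.F-∘ G (F₁ F g) (F₁ F f))
  }

record _≡F_ {C : Category o ℓ} {D : Category o' ℓ'} (F G : Functor C D)
            : Set (o ⊔ ℓ ⊔ o' ⊔ ℓ') where
  field
    eq₀ : ∀ X → F₀ F X ≡ F₀ G X
    eq₁ : ∀ {X Y} (f : Hom C X Y) → HomEq D (F₁ F f) (F₁ G f)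

record Terminal (C : Category o ℓ) : Set (o ⊔ ℓ) where
  open Category C using (_∘_; id)
  field
    ⊤       : Obj C
    !       : ∀ X → Hom C X ⊤
    !-unique : ∀ {X} (f : Hom C X ⊤) → f ≡ ! X

record IsPullback (C : Category o ℓ) {P A B Z : Obj C}
                  (p₁ : Hom C P A) (p₂ : Hom C P B)
                  (f : Hom C A Z) (g : Hom C B Z) : Set (o ⊔ ℓ) where
  open Category C using (_∘_; id)
  field
    commute   : f ∘ p₁ ≡ g ∘ p₂
    universal : ∀ {W} (u : Hom C W A) (v : Hom C W B) → f ∘ u ≡ g ∘ v →
                Σ[ h ∈ Hom C W P ] (p₁ ∘ h ≡ u × p₂ ∘ h ≡ v)
    unique    : ∀ {W} (h h' : Hom C W P) →
                p₁ ∘ h ≡ p₁ ∘ h' → p₂ ∘ h ≡ p₂ ∘ h' → h ≡ h'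

record IsIso (C : Category o ℓ) {X Y : Obj C} (f : Hom C X Y) : Set ℓ where
  open Category C using (_∘_; id)
  field
    inv  : Hom C Y X
    invˡ : inv ∘ f ≡ id
    invʳ : f ∘ inv ≡ id

record SymMonoidal (C : Category o ℓ) : Set (o ⊔ ℓ) where
  open Category C using (_∘_; id)
  infixr 10 _⊗₀_ _⊗₁_
  field
    _⊗₀_ : Obj C → Obj C → Obj C
    _⊗₁_ : ∀ {X X' Y Y'} → Hom C X X' → Hom C Y Y' → Hom C (X ⊗₀ Y) (X' ⊗₀ Y')
    ⊗-id : ∀ {X Y} → id {X} ⊗₁ id {Y} ≡ id
    ⊗-∘  : ∀ {X X' X'' Y Y' Y''} (g : Hom C X' X'') (f : Hom C X X')
             (g' : Hom C Y' Y'') (f' : Hom C Y Y') →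
           (g ∘ f) ⊗₁ (g' ∘ f') ≡ (g ⊗₁ g') ∘ (f ⊗₁ f')
    unit : Obj C
    α     : ∀ X Y Z → Hom C ((X ⊗₀ Y) ⊗₀ Z) (X ⊗₀ (Y ⊗₀ Z))
    α-iso : ∀ X Y Z → IsIso C (α X Y Z)
    α-natural : ∀ {X X' Y Y' Z Z'} (f : Hom C X X') (g : Hom C Y Y') (h : Hom C Z Z') →
                α X' Y' Z' ∘ ((f ⊗₁ g) ⊗₁ h) ≡ (f ⊗₁ (g ⊗₁ h)) ∘ α X Y Z
    λ⊗     : ∀ X → Hom C (unit ⊗₀ X) X
    λ⊗-iso : ∀ X → IsIso C (λ⊗ X)
    λ⊗-natural : ∀ {X Y} (f : Hom C X Y) → λ⊗ Y ∘ (id ⊗₁ f) ≡ f ∘ λ⊗ X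
    ρ⊗     : ∀ X → Hom C (X ⊗₀ unit) X
    ρ⊗-iso : ∀ X → IsIso C (ρ⊗ X)
    ρ⊗-natural : ∀ {X Y} (f : Hom C X Y) → ρ⊗ Y ∘ (f ⊗₁ id) ≡ f ∘ ρ⊗ X
    pentagon : ∀ W X Y Z →
      (id {W} ⊗₁ α X Y Z) ∘ α W (X ⊗₀ Y) Z ∘ (α W X Y ⊗₁ id {Z})
        ≡ α W X (Y ⊗₀ Z) ∘ α (W ⊗₀ X) Y Z
    triangle : ∀ X Y → (id {X} ⊗₁ λ⊗ Y) ∘ α X unit Y ≡ ρ⊗ X ⊗₁ id {Y}
    σ : ∀ X Y → Hom C (X ⊗₀ Y) (Y ⊗₀ X)
    σ-natural : ∀ {X X' Y Y'} (f : Hom C X X') (g : Hom C Y Y') →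
                σ X' Y' ∘ (f ⊗₁ g) ≡ (g ⊗₁ f) ∘ σ X Y
    σ-involutive : ∀ X Y → σ Y X ∘ σ X Y ≡ id
    hexagon : ∀ X Y Z →
      α Y Z X ∘ σ X (Y ⊗₀ Z) ∘ α X Y Z
        ≡ (id {Y} ⊗₁ σ X Z) ∘ α Y X Z ∘ (σ X Y ⊗₁ id {Z})

record IsStrictSymMonoidal {C : Category o ℓ} {D : Category o' ℓ'}
         (M : SymMonoidal C) (N : SymMonoidal D) (F : Functor C D)
         : Set (o ⊔ ℓ ⊔ o' ⊔ ℓ') where
  module M = SymMonoidal M
  module N = SymMonoidal N
  field
    pres-⊗₀  : ∀ X Y → F₀ F (X M.⊗₀ Y) ≡ F₀ F X N.⊗₀ F₀ F Y
    pres-⊗₁  : ∀ {X X' Y Y'} (f : Hom C X X') (g : Hom C Y Y') →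
               HomEq D (F₁ F (f M.⊗₁ g)) (F₁ F f N.⊗₁ F₁ F g)
    pres-unit : F₀ F M.unit ≡ N.unit
    pres-α   : ∀ X Y Z → HomEq D (F₁ F (M.α X Y Z)) (N.α (F₀ F X) (F₀ F Y) (F₀ F Z))
    pres-λ   : ∀ X → HomEq D (F₁ F (M.λ⊗ X)) (N.λ⊗ (F₀ F X))
    pres-ρ   : ∀ X → HomEq D (F₁ F (M.ρ⊗ X)) (N.ρ⊗ (F₀ F X))
    pres-σ   : ∀ X Y → HomEq D (F₁ F (M.σ X Y)) (N.σ (F₀ F X) (F₀ F Y))

-- Split fibrations over C, presented (Grothendieck) as strict functors
-- C^op → Cat: fibres Fib Γ and reindexing functors f^* with
-- id^* = Id and (g ∘ f)^* = f^* g^* strictly.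

record SplitFibration (C : Category o ℓ) (o' ℓ' : Level)
       : Set (o ⊔ ℓ ⊔ lsuc (o' ⊔ ℓ')) where
  open Category C using (_∘_; id)
  field
    Fib     : Obj C → Category o' ℓ'
    reindex : ∀ {Δ Γ} → Hom C Δ Γ → Functor (Fib Γ) (Fib Δ)
    reindex-id : ∀ {Γ} → reindex (id {Γ}) ≡F IdF (Fib Γ)
    reindex-∘  : ∀ {Θ Δ Γ} (f : Hom C Θ Δ) (g : Hom C Δ Γ) →
                 reindex (g ∘ f) ≡F (reindex f ∘F reindex g)

  _^*₀_ : ∀ {Δ Γ} → Hom C Δ Γ → Obj (Fib Γ) → Obj (Fib Δ)
  f ^*₀ X = F₀ (reindex f) X

  _^*₁_ : ∀ {Δ Γ} (f : Hom C Δ Γ) {X Y : Obj (Fib Γ)} →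
          Hom (Fib Γ) X Y → Hom (Fib Δ) (f ^*₀ X) (f ^*₀ Y)
  f ^*₁ h = F₁ (reindex f) h

  infixr 8 _^*₀_ _^*₁_

record SplitSymMonoidalFibration (C : Category o ℓ) (o' ℓ' : Level)
       : Set (o ⊔ ℓ ⊔ lsuc (o' ⊔ ℓ')) where
  field
    fibration : SplitFibration C o' ℓ'
  open SplitFibration fibration
  field
    monoidal : ∀ Γ → SymMonoidal (Fib Γ)
    reindex-strict : ∀ {Δ Γ} (f : Hom C Δ Γ) →
                     IsStrictSymMonoidal (monoidal Γ) (monoidal Δ) (reindex f)

-- Full split comprehension category  π : T → C^→  over a split fibration T.
-- Γ · A is the context extension, π A : Γ · A → Γ the display map,
-- πₕ h the image of a vertical morphism, q f A the image of the
-- (split) cartesian lift  f^*A → A.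

record FullSplitComprehension (C : Category o ℓ) (T : SplitFibration C o' ℓ')
       : Set (o ⊔ ℓ ⊔ o' ⊔ ℓ') where
  open Category C using (_∘_; id)
  open SplitFibration T
  TObj : Obj C → Set o'
  TObj Γ = Obj (Fib Γ)
  field
    _·_ : (Γ : Obj C) → TObj Γ → Obj C
    π   : ∀ {Γ} (A : TObj Γ) → Hom C (Γ · A) Γ
    πₕ      : ∀ {Γ} {A B : TObj Γ} → Hom (Fib Γ) A B → Hom C (Γ · A) (Γ · B)
    πₕ-over : ∀ {Γ} {A B : TObj Γ} (h : Hom (Fib Γ) A B) → π B ∘ πₕ h ≡ π A
    πₕ-id   : ∀ {Γ} {A : TObj Γ} → πₕ (Category.id (Fib Γ) {A}) ≡ id
    πₕ-∘    : ∀ {Γ} {A B D : TObj Γ} (g : Hom (Fib Γ) B D) (h : Hom (Fib Γ) A B) →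
              πₕ (Category._∘_ (Fib Γ) g h) ≡ πₕ g ∘ πₕ h
    q        : ∀ {Δ Γ} (f : Hom C Δ Γ) (A : TObj Γ) → Hom C (Δ · (f ^*₀ A)) (Γ · A)
    q-pullback : ∀ {Δ Γ} (f : Hom C Δ Γ) (A : TObj Γ) →
                 IsPullback C (π (f ^*₀ A)) (q f A) f (π A)
    q-natural  : ∀ {Δ Γ} (f : Hom C Δ Γ) {A B : TObj Γ} (h : Hom (Fib Γ) A B) →
                 q f B ∘ πₕ (f ^*₁ h) ≡ πₕ h ∘ q f A
    q-id : ∀ {Γ} (A : TObj Γ) → HomEq C (q (id {Γ}) A) (id {Γ · A})
    q-∘  : ∀ {Θ Δ Γ} (f : Hom C Θ Δ) (g : Hom C Δ Γ) (A : TObj Γ) →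
           HomEq C (q (g ∘ f) A) (q g A ∘ q f (g ^*₀ A))
    full     : ∀ {Γ} {A B : TObj Γ} (k : Hom C (Γ · A) (Γ · B)) → π B ∘ k ≡ π A →
               Σ[ h ∈ Hom (Fib Γ) A B ] πₕ h ≡ k
    faithful : ∀ {Γ} {A B : TObj Γ} (h h' : Hom (Fib Γ) A B) → πₕ h ≡ πₕ h' → h ≡ h'

record Model (o ℓ ot ℓt ol ℓl : Level)
       : Set (lsuc (o ⊔ ℓ ⊔ ot ⊔ ℓt ⊔ ol ⊔ ℓl)) where
  field
    Ctx      : Category o ℓ
    terminal : Terminal Ctx
    Ty       : SplitFibration Ctx ot ℓt
    compr    : FullSplitComprehension Ctx Ty
    Lin      : SplitSymMonoidalFibration Ctx ol ℓl

  module Tyᶠ  = SplitFibration Ty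
  module Linᶠ = SplitFibration (SplitSymMonoidalFibration.fibration Lin)
  open Category Ctx public using (_∘_; id)
  open FullSplitComprehension compr public using (TObj; _·_; π; πₕ; q; q-pullback)

  LObj : Obj Ctx → Set ol
  LObj Γ = Obj (Linᶠ.Fib Γ)

-- Path  q^*(π_{E'}^* X) ≡ π_{f^*E'}^*(f^* X)  used in Beck–Chevalley,
-- coming from the commuting pullback square  π_{E'} ∘ q = f ∘ π_{f^*E'}.
module _ {o ℓ ot ℓt ol ℓl} (M : Model o ℓ ot ℓt ol ℓl) where
  open Model M
  open Tyᶠ

  bcPath : ∀ {Γ Δ} (f : Hom Ctx Γ Δ) (E' : TObj Δ) (X : TObj Δ) →
           q f E' ^*₀ (π E' ^*₀ X) ≡ π (f ^*₀ E') ^*₀ (f ^*₀ X)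
  bcPath f E' X =
    trans (sym (_≡F_.eq₀ (reindex-∘ (q f E') (π E')) X))
      (trans (cong (λ g → g ^*₀ X) (sym (IsPullback.commute (q-pullback f E'))))
             (_≡F_.eq₀ (reindex-∘ (π (f ^*₀ E')) f) X))

record HasΣ {o ℓ ot ℓt ol ℓl} (M : Model o ℓ ot ℓt ol ℓl)
       : Set (o ⊔ ℓ ⊔ ot ⊔ ℓt) where
  open Model M
  open Tyᶠ
  field
    -- (1) Σ_A ⊣ π_A^*, given by universal arrows (unit η)
    Σ' : ∀ {Γ} (A : TObj Γ) → TObj (Γ · A) → TObj Γ
    η  : ∀ {Γ} {A : TObj Γ} (B : TObj (Γ · A)) →
         Hom (Fib (Γ · A)) B (π A ^*₀ Σ' A B)
    transpose : ∀ {Γ} {A : TObj Γ} {B : TObj (Γ · A)} {D : TObj Γ} →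
                Hom (Fib (Γ · A)) B (π A ^*₀ D) → Hom (Fib Γ) (Σ' A B) D
    transpose-β : ∀ {Γ} {A : TObj Γ} {B : TObj (Γ · A)} {D : TObj Γ}
                    (h : Hom (Fib (Γ · A)) B (π A ^*₀ D)) →
                  Category._∘_ (Fib (Γ · A)) (π A ^*₁ transpose h) (η B) ≡ h
    transpose-unique : ∀ {Γ} {A : TObj Γ} {B : TObj (Γ · A)} {D : TObj Γ}
                    (h : Hom (Fib (Γ · A)) B (π A ^*₀ D)) (k : Hom (Fib Γ) (Σ' A B) D) →
                  Category._∘_ (Fib (Γ · A)) (π A ^*₁ k) (η B) ≡ h → k ≡ transpose h
    -- (2) Beck–Chevalley: the canonical  Σ_{f^*E'} q^* B → f^* Σ_{E'} B  is iso
    beck-chevalley : ∀ {Γ Δ} (f : Hom Ctx Γ Δ) (E' : TObj Δ) (B : TObj (Δ · E')) →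
      IsIso (Fib Γ)
        (transpose {B = q f E' ^*₀ B}
           (subst (Hom (Fib (Γ · (f ^*₀ E'))) (q f E' ^*₀ B))
                  (bcPath M f E' (Σ' E' B))
                  (q f E' ^*₁ η B)))
    -- (3) pair_{A,B} = q_{π_A, Σ_A B} ∘ π(η_B) : Γ.A.B → Γ.Σ_A B is iso,
    --     with inverse (pr₁,pr₂)
    pr₁pr₂ : ∀ {Γ} {A : TObj Γ} (B : TObj (Γ · A)) → Hom Ctx (Γ · Σ' A B) ((Γ · A) · B)
    pair-invˡ : ∀ {Γ} {A : TObj Γ} (B : TObj (Γ · A)) →
                pr₁pr₂ B ∘ (q (π A) (Σ' A B) ∘ πₕ (η B)) ≡ id
    pair-invʳ : ∀ {Γ} {A : TObj Γ} (B : TObj (Γ · A)) →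
                (q (π A) (Σ' A B) ∘ πₕ (η B)) ∘ pr₁pr₂ B ≡ id

  pair : ∀ {Γ} {A : TObj Γ} (B : TObj (Γ · A)) → Hom Ctx ((Γ · A) · B) (Γ · Σ' A B)
  pair {A = A} B = q (π A) (Σ' A B) ∘ πₕ (η B)

module Submission where

-- Condition (3) of Σ-types says that
-- pair : Γ.A.B → Γ.Σ_A B is an isomorphism with inverse (pr₁,pr₂); only
-- this part of the Σ-structure is needed.  In any split fibration, a
-- vertical morphism  c : Ξ → i^*C  over the domain of an isomorphism i
-- with inverse j can be transposed to  c̃ = j^*c : j^*Ξ → C  (using
-- j^* i^* = (i ∘ j)^* = id^* = Id), and reindexing c̃ back along i ∘ u
-- recovers u^*c for every u, because (i ∘ u)^* c̃ = u^* i^* j^* c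
-- = u^* (j ∘ i)^* c = u^* c.

open import Defs
open import Data.Product using (Σ; Σ-syntax; _,_)
open import Relation.Binary.PropositionalEquality using (_≡_; refl; sym; trans; cong; subst)
open import Relation.Binary.HeterogeneousEquality using (refl)
open import Level using (Level)

module _ {o ℓ : Level} {D : Category o ℓ} where

  HomEq-refl : ∀ {X Y} (f : Hom D X Y) → HomEq D f f
  HomEq-refl f = homEq refl refl refl

  HomEq-sym : ∀ {X Y X' Y'} {f : Hom D X Y} {g : Hom D X' Y'} →
              HomEq D f g → HomEq D g f
  HomEq-sym (homEq refl refl refl) = homEq refl refl refl

  HomEq-trans : ∀ {X Y X' Y' X'' Y''}
                  {f : Hom D X Y} {g : Hom D X' Y'} {h : Hom D X'' Y''} →
                HomEq D f g → HomEq D g h → HomEq D f h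
  HomEq-trans (homEq refl refl refl) (homEq refl refl refl) = homEq refl refl refl

  HomEq-subst : ∀ {X Y Y'} (p : Y ≡ Y') (f : Hom D X Y) →
                HomEq D (subst (Hom D X) p f) f
  HomEq-subst refl f = HomEq-refl f

F₁-resp-HomEq : ∀ {o ℓ o' ℓ'} {C : Category o ℓ} {D : Category o' ℓ'}
                  (F : Functor C D) {X Y X' Y'} {f : Hom C X Y} {g : Hom C X' Y'} →
                HomEq C f g → HomEq D (F₁ F f) (F₁ F g)
F₁-resp-HomEq F (homEq refl refl refl) = homEq refl refl refl

module SplitFibrationFacts {o ℓ o' ℓ' : Level} {C : Category o ℓ}
                           (T : SplitFibration C o' ℓ') where
  open SplitFibration T
  open Category C using (_∘_; id)

  reindex-resp-≡ : ∀ {Δ Γ} {f g : Hom C Δ Γ} → f ≡ g →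
                   ∀ {X Y} (h : Hom (Fib Γ) X Y) → HomEq (Fib Δ) (f ^*₁ h) (g ^*₁ h)
  reindex-resp-≡ {f = f} refl h = HomEq-refl (f ^*₁ h)

  reindex-∘₁ : ∀ {Θ Δ Γ} (f : Hom C Θ Δ) (g : Hom C Δ Γ) {X Y} (h : Hom (Fib Γ) X Y) →
               HomEq (Fib Θ) ((g ∘ f) ^*₁ h) (f ^*₁ (g ^*₁ h))
  reindex-∘₁ f g h = _≡F_.eq₁ (reindex-∘ f g) h

  reindex-retraction₀ : ∀ {Δ Γ} {i : Hom C Δ Γ} {j : Hom C Γ Δ} → j ∘ i ≡ id →
                        ∀ X → i ^*₀ (j ^*₀ X) ≡ X
  reindex-retraction₀ {i = i} {j} ji=id X =
    trans (sym (_≡F_.eq₀ (reindex-∘ i j) X))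
          (trans (cong (λ g → g ^*₀ X) ji=id) (_≡F_.eq₀ reindex-id X))

  reindex-retraction₁ : ∀ {Δ Γ} {i : Hom C Δ Γ} {j : Hom C Γ Δ} → j ∘ i ≡ id →
                        ∀ {X Y} (h : Hom (Fib Δ) X Y) → HomEq (Fib Δ) (i ^*₁ (j ^*₁ h)) h
  reindex-retraction₁ {i = i} {j} ji=id h =
    HomEq-trans (HomEq-sym (reindex-∘₁ i j h))
      (HomEq-trans (reindex-resp-≡ ji=id h) (_≡F_.eq₁ reindex-id h))

  module TransposeAlongIso {Δ Γ} (i : Hom C Δ Γ) (j : Hom C Γ Δ) (ij=id : i ∘ j ≡ id)
                   {Ξ : Obj (Fib Δ)} {C′ : Obj (Fib Γ)} (c : Hom (Fib Δ) Ξ (i ^*₀ C′)) where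

    isoTranspose : Hom (Fib Γ) (j ^*₀ Ξ) C′
    isoTranspose = subst (Hom (Fib Γ) (j ^*₀ Ξ)) (reindex-retraction₀ ij=id C′) (j ^*₁ c)

    isoTranspose-reindex : j ∘ i ≡ id → ∀ {Θ} (u : Hom C Θ Δ) →
                        HomEq (Fib Θ) ((i ∘ u) ^*₁ isoTranspose) (u ^*₁ c)
    isoTranspose-reindex ji=id u =
      HomEq-trans (reindex-∘₁ u i isoTranspose)
        (F₁-resp-HomEq (reindex u)
          (HomEq-trans (F₁-resp-HomEq (reindex i)
                          (HomEq-subst (reindex-retraction₀ ij=id C′) (j ^*₁ c)))
                       (reindex-retraction₁ ji=id c)))

mainTheorem3 : ∀ {o ℓ ot ℓt ol ℓl} (M : Model o ℓ ot ℓt ol ℓl) (S : HasΣ M) →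
    let open Model M
        open HasΣ S
        open Linᶠ
    in ∀ {Γ} {A : TObj Γ} {B : TObj (Γ · A)}
         (C : LObj (Γ · Σ' A B)) (Ξ : LObj ((Γ · A) · B))
         (c : Hom (Fib ((Γ · A) · B)) Ξ (pair B ^*₀ C)) →
       Σ[ ĉ ∈ ((s : Hom Ctx Γ (Γ · Σ' A B)) → π (Σ' A B) ∘ s ≡ id →
               Hom (Fib Γ) (s ^*₀ (pr₁pr₂ B ^*₀ Ξ)) (s ^*₀ C)) ]
         ((a : Hom Ctx Γ (Γ · A)) → π A ∘ a ≡ id →
          (b : Hom Ctx (Γ · A) ((Γ · A) · B)) → π B ∘ b ≡ id →
          (s : Hom Ctx Γ (Γ · Σ' A B)) (s-sec : π (Σ' A B) ∘ s ≡ id) →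
          s ≡ pair B ∘ (b ∘ a) →
          HomEq (Fib Γ) (ĉ s s-sec) (a ^*₁ (b ^*₁ c)))
mainTheorem3 M S {Γ} {A} {B} C Ξ c = (λ s _ → s ^*₁ c̃) , ĉ-on-pairs
  where
    open Model M
    open HasΣ S
    open Linᶠ
    open SplitFibrationFacts (SplitSymMonoidalFibration.fibration Lin)
    open TransposeAlongIso (pair B) (pr₁pr₂ B) (pair-invʳ B) c

    c̃ : Hom (Fib (Γ · Σ' A B)) (pr₁pr₂ B ^*₀ Ξ) C
    c̃ = isoTranspose

    -- At s = (a,b) = pair ∘ (b ∘ a):  s^* c̃ = (b ∘ a)^* c = a^* b^* c.
    ĉ-on-pairs : (a : Hom Ctx Γ (Γ · A)) → π A ∘ a ≡ id →
                 (b : Hom Ctx (Γ · A) ((Γ · A) · B)) → π B ∘ b ≡ id →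
                 (s : Hom Ctx Γ (Γ · Σ' A B)) → π (Σ' A B) ∘ s ≡ id →
                 s ≡ pair B ∘ (b ∘ a) →
                 HomEq (Fib Γ) (s ^*₁ c̃) (a ^*₁ (b ^*₁ c))
    ĉ-on-pairs a _ b _ s _ refl =
      HomEq-trans (isoTranspose-reindex (pair-invˡ B) (b ∘ a)) (reindex-∘₁ a b c)
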